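{- Let $G=(V,E)$ be a finite simple graph of order $n$. For each collection $\mathcal{F}$ of pairwise disjoint forts of $G$, there exist $x\in\{0,1\}^{n\times V}$ (entries $x_{iu}$, $i\in\{1,\ldots,n\}$, $u\in V$) and $z\in\{0,1\}^n$ satisfying (1) $z_i-\sum_{u\in V}x_{iu}\le0$ for all $i$; (2) $x_{iu}-x_{iv}+\sum_{w\in N(u)\setminus\{v\}}x_{iw}\ge0$ for all $i$, $v\in V$, $u\in N(v)$; (3) $\sum_{i=1}^n x_{iu}\le1$ for all $u\in V$, such that $|\mathcal{F}|=\sum_{i=1}^n z_i$.
   Context: $N(u)$ is the neighborhood of $u$. A fort of $G$ is a non-empty set $F\subseteq V$ such that no vertex $u\in V\setminus F$ has exactly one neighbor in $F$. -}

module Defs where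

open import Data.Nat using (ℕ; _≤_; _+_)
open import Data.Bool using (Bool; true; false; _∧_; not; if_then_else_)
open import Data.Fin using (Fin; _≟_)
open import Data.Fin.Subset using (Subset; _∈_; _∉_; _∩_; ∣_∣; Nonempty; Empty)
open import Data.Vec using (tabulate; sum)
open import Data.List using (List)
open import Data.List.Relation.Unary.All using (All)
open import Data.List.Relation.Unary.AllPairs using (AllPairs)
open import Relation.Binary.PropositionalEquality using (_≡_; _≢_)
open import Relation.Nullary.Decidable using (⌊_⌋)

record SimpleGraph (n : ℕ) : Set where
  field
    adj   : Fin n → Fin n → Bool
    sym   : ∀ u v → adj u v ≡ adj v u
    irrefl : ∀ u → adj u u ≡ false
open SimpleGraph public

N : ∀ {n} → SimpleGraph n → Fin n → Subset n
N G u = tabulate (adj G u)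

Σ[_] : ∀ {n} → (Fin n → ℕ) → ℕ
Σ[ f ] = sum (tabulate f)

IsFort : ∀ {n} → SimpleGraph n → Subset n → Set
IsFort G F = Nonempty F × (∀ u → u ∉ F → ∣ N G u ∩ F ∣ ≢ 1)
  where open import Data.Product using (_×_)

Disjoint : ∀ {n} → Subset n → Subset n → Set
Disjoint p q = Empty (p ∩ q)

-- A collection of pairwise disjoint forts (a list; since its members are
-- nonempty and pairwise disjoint they are automatically distinct, so the
-- length of the list is the cardinality of the collection).
DisjointForts : ∀ {n} → SimpleGraph n → List (Subset n) → Set
DisjointForts G 𝓕 = All (IsFort G) 𝓕 × AllPairs Disjoint 𝓕
  where open import Data.Product using (_×_)

ΣNbhdMinus : ∀ {n} → SimpleGraph n → Fin n → Fin n → (Fin n → ℕ) → ℕ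
ΣNbhdMinus G u v x = Σ[ (λ w → if adj G u w ∧ not ⌊ w ≟ v ⌋ then x w else 0) ]

{-# OPTIONS --safe #-}
module Submission where

-- Pick a vertex r_F in each fort F; as the forts are pairwise disjoint, these vertices
-- are distinct. Let row r_F of x be the indicator vector of F and z_{r_F} = 1, all other
-- rows and entries of z being 0. Then Σ z counts the forts, and the column sum at u counts
-- the forts containing u, which is at most 1 by disjointness. Constraint (2) is preserved
-- by sums of rows, so it only has to be checked for the indicator of a fort F: if v ∈ F
-- and u ∉ F is a neighbour of v, then v is a neighbour of u in F, and since u does not
-- have exactly one neighbour in F it has another one w ≠ v.

open import Defs hiding (sym)
open import Data.Bool using (Bool; true; false; _∧_; not; if_then_else_)
open import Data.Empty using (⊥-elim)
open import Data.Fin using (Fin; zero; suc; _≟_)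
open import Data.Fin.Subset using (Subset; _∈_; _∉_; _∩_; ∣_∣; Nonempty)
open import Data.Fin.Subset.Properties using (_∈?_; x∈p∩q⁺; x∈p⇒∣p-x∣<∣p∣)
open import Data.List using (List; []; _∷_; length)
open import Data.List.Relation.Unary.All as All using (All; []; _∷_)
open import Data.List.Relation.Unary.AllPairs using (AllPairs; []; _∷_)
open import Data.Nat using (ℕ; zero; suc; _≤_; _+_; z≤n)
open import Data.Nat.Properties
  using (+-0-commutativeMonoid; +-commutativeSemigroup; +-identityʳ; +-mono-≤;
         ≤-refl; ≤-reflexive; ≤-trans; m≤m+n; m<n⇒0<n; n≢0⇒n>0; module ≤-Reasoning)
open import Data.Product using (Σ; _×_; _,_; proj₁)
open import Data.Vec using (lookup; []; _∷_)
open import Data.Vec.Properties using ([]=⇒lookup; lookup⇒[]=; lookup-zipWith; lookup∘tabulate)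
open import Relation.Binary.PropositionalEquality
open import Relation.Nullary using (does; yes; no)
open import Relation.Nullary.Decidable using (⌊_⌋)
open import Algebra.Properties.CommutativeMonoid.Sum +-0-commutativeMonoid
  using (sum-cong-≗; ∑-distrib-+; sum-replicate-zero) renaming (sum to ∑)
open import Algebra.Properties.CommutativeSemigroup +-commutativeSemigroup using (interchange)

Σ≡∑ : ∀ {n} (f : Fin n → ℕ) → Σ[ f ] ≡ ∑ f
Σ≡∑ {zero}  f = refl
Σ≡∑ {suc n} f = cong (f zero +_) (Σ≡∑ (λ i → f (suc i)))

Σ-cong : ∀ {n} {f g : Fin n → ℕ} → (∀ i → f i ≡ g i) → Σ[ f ] ≡ Σ[ g ]
Σ-cong {f = f} {g} f≗g
  rewrite Σ≡∑ f | Σ≡∑ g = sum-cong-≗ f≗g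

Σ-distrib-+ : ∀ {n} (f g : Fin n → ℕ) → Σ[ (λ i → f i + g i) ] ≡ Σ[ f ] + Σ[ g ]
Σ-distrib-+ f g
  rewrite Σ≡∑ (λ i → f i + g i) | Σ≡∑ f | Σ≡∑ g = ∑-distrib-+ f g

Σ-zero : ∀ n → Σ[ (λ (_ : Fin n) → 0) ] ≡ 0
Σ-zero n = trans (Σ≡∑ {n} (λ _ → 0)) (sum-replicate-zero n)

-- Stated with `does` rather than ⌊_⌋: ⌊ suc w ≟ suc v ⌋ does not reduce to ⌊ w ≟ v ⌋.
Σ-select : ∀ {n} (f : Fin n → ℕ) (v : Fin n) → Σ[ (λ w → if does (w ≟ v) then f w else 0) ] ≡ f v
Σ-select {suc n} f zero    = trans (cong (f zero +_) (Σ-zero n)) (+-identityʳ (f zero))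
Σ-select {suc n} f (suc v) = Σ-select (λ i → f (suc i)) v

Σ-guarded-split : ∀ {n} (a : Fin n → Bool) (f : Fin n → ℕ) {v : Fin n} → a v ≡ true →
  Σ[ (λ w → if a w then f w else 0) ] ≡ f v + Σ[ (λ w → if a w ∧ not ⌊ w ≟ v ⌋ then f w else 0) ]
Σ-guarded-split a f {v} av = begin
  Σ[ g ]                               ≡⟨ Σ-cong split ⟩
  Σ[ (λ w → at-v w + away-from-v w) ]  ≡⟨ Σ-distrib-+ at-v away-from-v ⟩
  Σ[ at-v ] + Σ[ away-from-v ]         ≡⟨ cong (_+ Σ[ away-from-v ]) (Σ-select g v) ⟩
  g v + Σ[ away-from-v ]               ≡⟨ cong (λ b → (if b then f v else 0) + Σ[ away-from-v ]) av ⟩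
  f v + Σ[ away-from-v ]               ∎
  where
  open ≡-Reasoning
  g at-v away-from-v : Fin _ → ℕ
  g w           = if a w then f w else 0
  at-v w        = if does (w ≟ v) then g w else 0
  away-from-v w = if a w ∧ not ⌊ w ≟ v ⌋ then f w else 0
  split : ∀ w → g w ≡ at-v w + away-from-v w
  split w with w ≟ v | a w
  ... | yes _ | true  = sym (+-identityʳ (f w))
  ... | yes _ | false = refl
  ... | no _  | true  = refl
  ... | no _  | false = refl

indicator : ∀ {n} → Subset n → Fin n → ℕ
indicator p u = if lookup p u then 1 else 0

indicator-∈ : ∀ {n} {p : Subset n} {u} → u ∈ p → indicator p u ≡ 1
indicator-∈ u∈p = cong (λ b → if b then 1 else 0) ([]=⇒lookup u∈p)

indicator-∉ : ∀ {n} {p : Subset n} {u} → u ∉ p → indicator p u ≡ 0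
indicator-∉ {p = p} {u} u∉p with lookup p u in eq
... | true  = ⊥-elim (u∉p (lookup⇒[]= u p eq))
... | false = refl

indicator≤1 : ∀ {n} (p : Subset n) u → indicator p u ≤ 1
indicator≤1 p u with lookup p u
... | true  = ≤-refl
... | false = z≤n

∣p∣≡Σindicator : ∀ {n} (p : Subset n) → ∣ p ∣ ≡ Σ[ indicator p ]
∣p∣≡Σindicator []          = refl
∣p∣≡Σindicator (true ∷ p)  = cong suc (∣p∣≡Σindicator p)
∣p∣≡Σindicator (false ∷ p) = ∣p∣≡Σindicator p

nonempty⇒1≤Σindicator : ∀ {n} {p : Subset n} → Nonempty p → 1 ≤ Σ[ indicator p ]
nonempty⇒1≤Σindicator {p = p} (_ , x∈p) =
  ≤-trans (m<n⇒0<n (x∈p⇒∣p-x∣<∣p∣ x∈p)) (≤-reflexive (∣p∣≡Σindicator p))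

module _ {n : ℕ} where

  multiplicity : List (Subset n) → Fin n → ℕ
  multiplicity []      u = 0
  multiplicity (F ∷ 𝓕) u = indicator F u + multiplicity 𝓕 u

  multiplicity-disjoint≡0 : ∀ {F 𝓕 u} → u ∈ F → All (Disjoint F) 𝓕 → multiplicity 𝓕 u ≡ 0
  multiplicity-disjoint≡0 u∈F []       = refl
  multiplicity-disjoint≡0 u∈F (d ∷ ds) =
    cong₂ _+_ (indicator-∉ (λ u∈F′ → d (_ , x∈p∩q⁺ (u∈F , u∈F′)))) (multiplicity-disjoint≡0 u∈F ds)

  multiplicity≤1 : ∀ {𝓕 u} → AllPairs Disjoint 𝓕 → multiplicity 𝓕 u ≤ 1
  multiplicity≤1 [] = z≤n
  multiplicity≤1 {F ∷ _} {u} (ds ∷ dss) with u ∈? F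
  ... | yes u∈F rewrite indicator-∈ u∈F | multiplicity-disjoint≡0 u∈F ds = ≤-refl
  ... | no u∉F  rewrite indicator-∉ u∉F = multiplicity≤1 dss

  module _ (G : SimpleGraph n) where

    FortConstraint : (Fin n → ℕ) → Set
    FortConstraint f = ∀ v u → u ∈ N G v → f v ≤ f u + ΣNbhdMinus G u v f

    ΣNbhdMinus-distrib-+ : ∀ u v (f g : Fin n → ℕ) →
      ΣNbhdMinus G u v (λ w → f w + g w) ≡ ΣNbhdMinus G u v f + ΣNbhdMinus G u v g
    ΣNbhdMinus-distrib-+ u v f g = trans (Σ-cong guard-distrib) (Σ-distrib-+ (guarded f) (guarded g))
      where
      guarded : (Fin n → ℕ) → Fin n → ℕ
      guarded h w = if adj G u w ∧ not ⌊ w ≟ v ⌋ then h w else 0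
      guard-distrib : ∀ w → guarded (λ w′ → f w′ + g w′) w ≡ guarded f w + guarded g w
      guard-distrib w with adj G u w ∧ not ⌊ w ≟ v ⌋
      ... | true  = refl
      ... | false = refl

    FortConstraint-+ : ∀ {f g} → FortConstraint f → FortConstraint g →
      FortConstraint (λ u → f u + g u)
    FortConstraint-+ {f} {g} cf cg v u u∈Nv = begin
      f v + g v                        ≤⟨ +-mono-≤ (cf v u u∈Nv) (cg v u u∈Nv) ⟩
      (f u + S f) + (g u + S g)        ≡⟨ interchange (f u) (S f) (g u) (S g) ⟩
      (f u + g u) + (S f + S g)        ≡⟨ cong (f u + g u +_) (ΣNbhdMinus-distrib-+ u v f g) ⟨
      (f u + g u) + S (λ w → f w + g w) ∎
      where
      open ≤-Reasoning
      S : (Fin n → ℕ) → ℕ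
      S = ΣNbhdMinus G u v

    FortConstraint-guard : ∀ {f} (b : Bool) → FortConstraint f →
      FortConstraint (λ u → if b then f u else 0)
    FortConstraint-guard true  cf = cf
    FortConstraint-guard false _  = λ _ _ _ → z≤n

    ∈N⇒adj : ∀ {u v} → u ∈ N G v → adj G u v ≡ true
    ∈N⇒adj {u} {v} u∈Nv =
      trans (SimpleGraph.sym G u v) (trans (sym (lookup∘tabulate (adj G v) u)) ([]=⇒lookup u∈Nv))

    ∣N∩p∣≡Σ : ∀ u (p : Subset n) → ∣ N G u ∩ p ∣ ≡ Σ[ (λ w → if adj G u w then indicator p w else 0) ]
    ∣N∩p∣≡Σ u p = trans (∣p∣≡Σindicator (N G u ∩ p)) (Σ-cong pointwise)
      where
      pointwise : ∀ w → indicator (N G u ∩ p) w ≡ (if adj G u w then indicator p w else 0)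
      pointwise w rewrite lookup-zipWith _∧_ w (N G u) p | lookup∘tabulate (adj G u) w
        with adj G u w
      ... | true  = refl
      ... | false = refl

    fort-second-neighbour : ∀ {F u v} → IsFort G F → u ∉ F → v ∈ F → adj G u v ≡ true →
      1 ≤ ΣNbhdMinus G u v (indicator F)
    fort-second-neighbour {F} {u} {v} (_ , no-single-neighbour) u∉F v∈F uv =
      n≢0⇒n>0 (λ others≡0 → no-single-neighbour u u∉F (trans count (cong suc others≡0)))
      where
      others : ℕ
      others = ΣNbhdMinus G u v (indicator F)
      count : ∣ N G u ∩ F ∣ ≡ 1 + others
      count = begin
        ∣ N G u ∩ F ∣                                        ≡⟨ ∣N∩p∣≡Σ u F ⟩
        Σ[ (λ w → if adj G u w then indicator F w else 0) ]  ≡⟨ Σ-guarded-split (adj G u) (indicator F) uv ⟩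
        indicator F v + others                               ≡⟨ cong (_+ others) (indicator-∈ v∈F) ⟩
        1 + others                                           ∎
        where open ≡-Reasoning

    fort⇒FortConstraint : ∀ {F} → IsFort G F → FortConstraint (indicator F)
    fort⇒FortConstraint {F} fort v u u∈Nv with v ∈? F | u ∈? F
    ... | no v∉F  | _ rewrite indicator-∉ v∉F = z≤n
    ... | yes v∈F | yes u∈F rewrite indicator-∈ v∈F | indicator-∈ u∈F = m≤m+n 1 _
    ... | yes v∈F | no u∉F  rewrite indicator-∈ v∈F | indicator-∉ u∉F =
      fort-second-neighbour fort u∉F v∈F (∈N⇒adj u∈Nv)

  row : ∀ {𝓕} → All Nonempty 𝓕 → Fin n → Fin n → ℕ
  row []                        i u = 0
  row (_∷_ {x = F} (r , _) ne) i u = (if does (i ≟ r) then indicator F u else 0) + row ne i u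

  used : ∀ {𝓕} → All Nonempty 𝓕 → Fin n → ℕ
  used []             i = 0
  used ((r , _) ∷ ne) i = (if does (i ≟ r) then 1 else 0) + used ne i

  row≤used : ∀ {𝓕} (ne : All Nonempty 𝓕) i u → row ne i u ≤ used ne i
  row≤used []                        i u = z≤n
  row≤used (_∷_ {x = F} (r , _) ne) i u = +-mono-≤ head (row≤used ne i u)
    where
    head : (if does (i ≟ r) then indicator F u else 0) ≤ (if does (i ≟ r) then 1 else 0)
    head with does (i ≟ r)
    ... | true  = indicator≤1 F u
    ... | false = z≤n

  used≤multiplicity : ∀ {𝓕} (ne : All Nonempty 𝓕) i → used ne i ≤ multiplicity 𝓕 i
  used≤multiplicity []                          i = z≤n
  used≤multiplicity (_∷_ {x = F} (r , r∈F) ne) i = +-mono-≤ head (used≤multiplicity ne i)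
    where
    head : (if does (i ≟ r) then 1 else 0) ≤ indicator F i
    head with i ≟ r
    ... | yes refl = ≤-reflexive (sym (indicator-∈ r∈F))
    ... | no _     = z≤n

  used≤Σrow : ∀ {𝓕} (ne : All Nonempty 𝓕) i → used ne i ≤ Σ[ row ne i ]
  used≤Σrow []                             i = z≤n
  used≤Σrow (_∷_ {x = F} (r , r∈F) ne) i = begin
    (if does (i ≟ r) then 1 else 0) + used ne i           ≤⟨ +-mono-≤ head (used≤Σrow ne i) ⟩
    Σ[ placed ] + Σ[ row ne i ]                           ≡⟨ Σ-distrib-+ placed (row ne i) ⟨
    Σ[ row (_∷_ {x = F} (r , r∈F) ne) i ]                 ∎
    where
    open ≤-Reasoning
    placed : Fin n → ℕ
    placed u = if does (i ≟ r) then indicator F u else 0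
    head : (if does (i ≟ r) then 1 else 0) ≤ Σ[ placed ]
    head with does (i ≟ r)
    ... | true  = nonempty⇒1≤Σindicator (r , r∈F)
    ... | false = z≤n

  Σcolumn≡multiplicity : ∀ {𝓕} (ne : All Nonempty 𝓕) u → Σ[ (λ i → row ne i u) ] ≡ multiplicity 𝓕 u
  Σcolumn≡multiplicity []                        u = Σ-zero n
  Σcolumn≡multiplicity (_∷_ {x = F} (r , _) ne) u =
    trans (Σ-distrib-+ (λ i → if does (i ≟ r) then indicator F u else 0) (λ i → row ne i u))
          (cong₂ _+_ (Σ-select (λ _ → indicator F u) r) (Σcolumn≡multiplicity ne u))

  Σused≡length : ∀ {𝓕} (ne : All Nonempty 𝓕) → Σ[ used ne ] ≡ length 𝓕
  Σused≡length []             = Σ-zero n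
  Σused≡length ((r , _) ∷ ne) =
    trans (Σ-distrib-+ (λ i → if does (i ≟ r) then 1 else 0) (used ne))
          (cong₂ _+_ (Σ-select (λ _ → 1) r) (Σused≡length ne))

  row-FortConstraint : ∀ (G : SimpleGraph n) {𝓕} (forts : All (IsFort G) 𝓕) i →
    FortConstraint G (row (All.map proj₁ forts) i)
  row-FortConstraint G []             i = λ _ _ _ → z≤n
  row-FortConstraint G (fort ∷ forts) i =
    FortConstraint-+ G (FortConstraint-guard G (does (i ≟ proj₁ (proj₁ fort))) (fort⇒FortConstraint G fort))
                       (row-FortConstraint G forts i)

theorem7p2 : ∀ {n} (G : SimpleGraph n) (𝓕 : List (Subset n)) → DisjointForts G 𝓕 →
    Σ (Fin n → Fin n → ℕ) λ x → Σ (Fin n → ℕ) λ z →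
      (∀ i u → x i u ≤ 1) × (∀ i → z i ≤ 1)
      × (∀ i → z i ≤ Σ[ (λ u → x i u) ])
      × (∀ i v u → u ∈ N G v → x i v ≤ x i u + ΣNbhdMinus G u v (x i))
      × (∀ u → Σ[ (λ i → x i u) ] ≤ 1)
      × (length 𝓕 ≡ Σ[ z ])
theorem7p2 G 𝓕 (forts , disjoint) =
  row ne , used ne ,
  (λ i u → ≤-trans (row≤used ne i u) (used≤1 i)) ,
  used≤1 ,
  used≤Σrow ne ,
  row-FortConstraint G forts ,
  (λ u → ≤-trans (≤-reflexive (Σcolumn≡multiplicity ne u)) (multiplicity≤1 disjoint)) ,
  sym (Σused≡length ne)
  where
  ne : All Nonempty 𝓕
  ne = All.map proj₁ forts
  used≤1 : ∀ i → used ne i ≤ 1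
  used≤1 i = ≤-trans (used≤multiplicity ne i) (multiplicity≤1 disjoint)
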